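{- Let $C$ be a cycle (with at least three vertices) and let $S,T \subseteq V(C)$ with $|S|,|T| > \tfrac{1}{3}|V(C)|$. Then there exists a path $P$ contained in $C$ with one end vertex in $S$ and the other end vertex in $T$ such that $2 \leq |V(P)| \leq \tfrac{1}{6}|V(C)| + 4$.
   Context: A path in a cycle $C$ means a subpath of $C$ (a set of consecutive vertices of $C$ together with the edges of $C$ between them). -}

module Defs where

open import Data.Nat using (ℕ; zero; suc; _∸_; _≤_)
open import Data.Nat.DivMod using (_mod_)
open import Data.Fin using (Fin; toℕ)
open import Data.Product using (_×_)

-- The cycle C_n: vertex set Fin n, with edges {i, i+1 mod n} (a cycle when n ≥ 3).
-- Successor of a vertex along the cycle.
next : ∀ {n} → Fin n → Fin n
next {suc m} i = suc (toℕ i) mod suc m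

walk : ∀ {n} → Fin n → ℕ → Fin n
walk i zero    = i
walk i (suc j) = next (walk i j)

-- A path in C_n (a subpath of the cycle): a start vertex together with its
-- number of vertices k, 1 ≤ k ≤ n.  Its vertex set is {start + j mod n | j < k}
-- (every subpath of C_n arises this way, traversing it in the increasing direction).
record CyclePath (n : ℕ) : Set where
  constructor path
  field
    start   : Fin n
    #vertices : ℕ
    nonempty : 1 ≤ #vertices
    fits     : #vertices ≤ n

open CyclePath public

-- Vertices of the path, indexed by position j (meaningful for j < #vertices).
vertexAt : ∀ {n} → CyclePath n → ℕ → Fin n
vertexAt P j = walk (start P) j

end₁ : ∀ {n} → CyclePath n → Fin n
end₁ P = start P

end₂ : ∀ {n} → CyclePath n → Fin n
end₂ P = walk (start P) (#vertices P ∸ 1)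

-- Let D = ⌈(n + 6) / 6⌉ and suppose no S-vertex and T-vertex (in either order) are joined by
-- a path of at most D + 1 vertices, since otherwise that path is the one sought.  Call a vertex
-- of S ∪ T an exit if the D vertices following it avoid S ∪ T.  The last S-vertex before a
-- T-vertex is an exit, and so is every vertex of S ∩ T; with |S| ≥ 2 this yields at least two
-- exits.  Each exit is followed by D empty vertices, and these runs are disjoint, so with e exits
-- and z empty vertices D e ≤ z.  Then |S| + |T| + z = n + |S ∩ T| ≤ n + e forces
-- |S| + |T| + 2 (D − 1) ≤ n, which contradicts |S|, |T| > n / 3 and 6 D ≥ n + 6.

module Submission where

open import Defs
open import Data.Nat using (ℕ; _≤_; _<_; _*_; _+_)
open import Data.Fin.Subset using (Subset; _∈_; ∣_∣)
open import Data.Product using (_×_; ∃-syntax)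
open import Data.Sum using (_⊎_)

open import Data.Nat using (zero; suc; z<s; z≤n; s≤s; s≤s⁻¹; _∸_; _%_; _/_; _≤?_)
open import Data.Nat.Properties
open import Data.Nat.DivMod
  using (_mod_; %-distribˡ-+; [m+n]%n≡m%n; m%n%n≡m%n; m%n<n; m<n⇒m%n≡m; m≡m%n+[m/n]*n)
open import Data.Nat.Solver using (module +-*-Solver)
open import Data.Bool using (Bool; true; false; _∧_; _∨_; not)
open import Data.Bool.Properties using (¬-not; ∨-comm) renaming (_≟_ to _≟ᵇ_)
open import Data.Fin as Fin using (Fin; toℕ)
open import Data.Fin.Properties using (toℕ-fromℕ<; toℕ<n)
open import Data.Vec using (Vec; []; _∷_; lookup)
open import Data.Vec.Properties using (lookup⇒[]=)
open import Data.Product using (_,_; proj₁; proj₂)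
open import Data.Sum using (inj₁; inj₂)
open import Data.Empty using (⊥; ⊥-elim)
open import Function using (_∘_)
open import Relation.Nullary using (¬_; Dec; yes; no; contradiction)
open import Relation.Nullary.Decidable using (_×-dec_; _⊎-dec_; ¬?; from-yes)
open import Relation.Binary using (tri<; tri≈; tri>)
open import Relation.Binary.PropositionalEquality
open +-*-Solver using (solve; _:+_; _:*_; _:=_; con)

-- Finite sums and counting

∑ : ℕ → (ℕ → ℕ) → ℕ
∑ zero    f = 0
∑ (suc k) f = ∑ k f + f k

syntax ∑ k (λ j → e) = ∑[ j < k ] e

∑-cong : ∀ k {f g : ℕ → ℕ} → (∀ {j} → j < k → f j ≡ g j) → ∑ k f ≡ ∑ k g
∑-cong zero    f≡g = refl
∑-cong (suc k) f≡g = cong₂ _+_ (∑-cong k (f≡g ∘ m<n⇒m<1+n)) (f≡g ≤-refl)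

∑-zero : ∀ k {f : ℕ → ℕ} → (∀ {j} → j < k → f j ≡ 0) → ∑ k f ≡ 0
∑-zero zero    f≡0 = refl
∑-zero (suc k) f≡0 = cong₂ _+_ (∑-zero k (f≡0 ∘ m<n⇒m<1+n)) (f≡0 ≤-refl)

∑-mono-≤ : ∀ k {f g : ℕ → ℕ} → (∀ {j} → j < k → f j ≤ g j) → ∑ k f ≤ ∑ k g
∑-mono-≤ zero    f≤g = z≤n
∑-mono-≤ (suc k) f≤g = +-mono-≤ (∑-mono-≤ k (f≤g ∘ m<n⇒m<1+n)) (f≤g ≤-refl)

∑-const : ∀ k c → ∑[ _ < k ] c ≡ k * c
∑-const zero    c = refl
∑-const (suc k) c = trans (cong (_+ c) (∑-const k c)) (+-comm (k * c) c)

∑-distrib-+ : ∀ k (f g : ℕ → ℕ) → ∑[ j < k ] (f j + g j) ≡ ∑ k f + ∑ k g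
∑-distrib-+ zero    f g = refl
∑-distrib-+ (suc k) f g =
  trans (cong (_+ (f k + g k)) (∑-distrib-+ k f g))
        (solve 4 (λ a b c d → (a :+ b) :+ (c :+ d) := (a :+ c) :+ (b :+ d)) refl
               (∑ k f) (∑ k g) (f k) (g k))

∑-comm : ∀ k l (f : ℕ → ℕ → ℕ) → ∑[ i < k ] ∑[ j < l ] f i j ≡ ∑[ j < l ] ∑[ i < k ] f i j
∑-comm zero    l f = sym (∑-zero l (λ _ → refl))
∑-comm (suc k) l f = trans (cong (_+ ∑ l (f k)) (∑-comm k l f))
                           (sym (∑-distrib-+ l (λ j → ∑[ i < k ] f i j) (f k)))

∑-unfoldˡ : ∀ k (f : ℕ → ℕ) → ∑ (suc k) f ≡ f 0 + ∑[ j < k ] f (suc j)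
∑-unfoldˡ zero    f = +-comm 0 (f 0)
∑-unfoldˡ (suc k) f = trans (cong (_+ f (suc k)) (∑-unfoldˡ k f)) (+-assoc (f 0) _ _)

∑-rotate : ∀ k (f : ℕ → ℕ) → (∀ j → f (j + k) ≡ f j) → ∀ c → ∑[ j < k ] f (c + j) ≡ ∑ k f
∑-rotate k f periodic zero    = refl
∑-rotate k f periodic (suc c) = trans shift (∑-rotate k f periodic c)
  where
  g : ℕ → ℕ
  g j = f (c + j)
  -- Moving the window one step drops g 0 and adds g k, which is g 0 again.
  shift : ∑[ j < k ] f (suc c + j) ≡ ∑ k g
  shift = +-cancelˡ-≡ (g 0) _ _ (begin
    g 0 + ∑[ j < k ] f (suc c + j)   ≡⟨ cong (g 0 +_) (∑-cong k (λ {j} _ → cong f (sym (+-suc c j)))) ⟩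
    g 0 + ∑[ j < k ] g (suc j)       ≡⟨ sym (∑-unfoldˡ k g) ⟩
    ∑ k g + g k                      ≡⟨ cong (∑ k g +_) (trans (periodic c) (cong f (sym (+-identityʳ c)))) ⟩
    ∑ k g + g 0                      ≡⟨ +-comm (∑ k g) (g 0) ⟩
    g 0 + ∑ k g                      ∎)
    where open ≡-Reasoning

∑-≥-term : ∀ k (f : ℕ → ℕ) {a} → a < k → f a ≤ ∑ k f
∑-≥-term (suc k) f {a} a<1+k with m≤n⇒m<n∨m≡n (s≤s⁻¹ a<1+k)
... | inj₁ a<k  = ≤-trans (∑-≥-term k f a<k) (m≤m+n _ _)
... | inj₂ refl = m≤n+m _ _

∑-≥-pair : ∀ k (f : ℕ → ℕ) {a b} → a < b → b < k → f a + f b ≤ ∑ k f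
∑-≥-pair (suc k) f a<b b<1+k with m≤n⇒m<n∨m≡n (s≤s⁻¹ b<1+k)
... | inj₁ b<k  = ≤-trans (∑-≥-pair k f a<b b<k) (m≤m+n _ _)
... | inj₂ refl = +-monoˡ-≤ (f _) (∑-≥-term k f a<b)

𝟙 : Bool → ℕ
𝟙 true  = 1
𝟙 false = 0

count : ℕ → (ℕ → Bool) → ℕ
count k p = ∑[ j < k ] 𝟙 (p j)

count-none : ∀ k {p : ℕ → Bool} → (∀ {j} → j < k → p j ≡ false) → count k p ≡ 0
count-none k none = ∑-zero k (cong 𝟙 ∘ none)

count-≥2 : ∀ k (p : ℕ → Bool) {a b} → a < k → b < k → a ≢ b →
           p a ≡ true → p b ≡ true → 2 ≤ count k p
count-≥2 k p {a} {b} a<k b<k a≢b pa pb with <-cmp a b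
... | tri< a<b _ _ = subst₂ (λ x y → 𝟙 x + 𝟙 y ≤ count k p) pa pb (∑-≥-pair k (𝟙 ∘ p) a<b b<k)
... | tri≈ _ a≡b _ = contradiction a≡b a≢b
... | tri> _ _ b<a = subst₂ (λ x y → 𝟙 x + 𝟙 y ≤ count k p) pb pa (∑-≥-pair k (𝟙 ∘ p) b<a a<k)

count-≤1 : ∀ k (p : ℕ → Bool) →
           (∀ {a b} → a < k → b < k → p a ≡ true → p b ≡ true → a ≡ b) → count k p ≤ 1
count-≤1 zero    p unique = z≤n
count-≤1 (suc k) p unique with p k in pk
... | false = subst (_≤ 1) (sym (+-identityʳ _))
                (count-≤1 k p (λ a<k b<k → unique (m<n⇒m<1+n a<k) (m<n⇒m<1+n b<k)))
... | true  = subst (λ c → c + 1 ≤ 1) (sym (count-none k before)) ≤-refl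
  where
  before : ∀ {j} → j < k → p j ≡ false
  before {j} j<k = ¬-not λ pj → <⇒≢ j<k (unique (m<n⇒m<1+n j<k) ≤-refl pj pk)

count-witness : ∀ k (p : ℕ → Bool) → 1 ≤ count k p → ∃[ j ] (j < k × p j ≡ true)
count-witness k p 1≤count with anyUpTo? (λ j → p j ≟ᵇ true) k
... | yes witness = witness
... | no  none    = contradiction (subst (1 ≤_) (count-none k absent) 1≤count) λ ()
  where
  absent : ∀ {j} → j < k → p j ≡ false
  absent j<k = ¬-not λ pj → none (_ , j<k , pj)

count-witness-≢ : ∀ k (p : ℕ → Bool) → 2 ≤ count k p → ∀ x → ∃[ j ] (j < k × j ≢ x × p j ≡ true)
count-witness-≢ k p 2≤count x with anyUpTo? (λ j → ¬? (j ≟ x) ×-dec (p j ≟ᵇ true)) k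
... | yes (j , j<k , j≢x , pj) = j , j<k , j≢x , pj
... | no  none = contradiction (≤-trans 2≤count (count-≤1 k p unique)) λ { (s≤s ()) }
  where
  only-x : ∀ {j} → j < k → p j ≡ true → j ≡ x
  only-x {j} j<k pj with j ≟ x
  ... | yes j≡x = j≡x
  ... | no  j≢x = contradiction (j , j<k , j≢x , pj) none
  unique : ∀ {a b} → a < k → b < k → p a ≡ true → p b ≡ true → a ≡ b
  unique a<k b<k pa pb = trans (only-x a<k pa) (sym (only-x b<k pb))

count-inclusion-exclusion : ∀ k (p q : ℕ → Bool) →
  count k p + count k q + count k (λ j → not (p j ∨ q j)) ≡ k + count k (λ j → p j ∧ q j)
count-inclusion-exclusion k p q = begin
  count k p + count k q + count k (λ j → not (p j ∨ q j))
    ≡⟨ cong (_+ count k (λ j → not (p j ∨ q j))) (sym (∑-distrib-+ k (𝟙 ∘ p) (𝟙 ∘ q))) ⟩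
  ∑[ j < k ] (𝟙 (p j) + 𝟙 (q j)) + count k (λ j → not (p j ∨ q j))
    ≡⟨ sym (∑-distrib-+ k _ _) ⟩
  ∑[ j < k ] (𝟙 (p j) + 𝟙 (q j) + 𝟙 (not (p j ∨ q j)))
    ≡⟨ ∑-cong k (λ {j} _ → pointwise (p j) (q j)) ⟩
  ∑[ j < k ] (1 + 𝟙 (p j ∧ q j))
    ≡⟨ ∑-distrib-+ k _ _ ⟩
  ∑[ _ < k ] 1 + count k (λ j → p j ∧ q j)
    ≡⟨ cong (_+ count k (λ j → p j ∧ q j)) (trans (∑-const k 1) (*-identityʳ k)) ⟩
  k + count k (λ j → p j ∧ q j) ∎
  where
  open ≡-Reasoning
  pointwise : ∀ x y → 𝟙 x + 𝟙 y + 𝟙 (not (x ∨ y)) ≡ 1 + 𝟙 (x ∧ y)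
  pointwise true  true  = refl
  pointwise true  false = refl
  pointwise false true  = refl
  pointwise false false = refl

count-mono : ∀ k {p q : ℕ → Bool} → (∀ {j} → j < k → p j ≡ true → q j ≡ true) → count k p ≤ count k q
count-mono k {p} {q} p⇒q = ∑-mono-≤ k λ {j} j<k → 𝟙-mono (p⇒q j<k)
  where
  𝟙-mono : ∀ {x y} → (x ≡ true → y ≡ true) → 𝟙 x ≤ 𝟙 y
  𝟙-mono {false} x⇒y = z≤n
  𝟙-mono {true}  x⇒y rewrite x⇒y refl = ≤-refl

last-true : (p : ℕ → Bool) → p 0 ≡ true → ∀ L →
            ∃[ i ] (i ≤ L × p i ≡ true × (∀ {j} → i < j → j ≤ L → p j ≡ false))
last-true p p0 zero = 0 , z≤n , p0 , λ 0<j j≤0 → contradiction j≤0 (<⇒≱ 0<j)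
last-true p p0 (suc L) with p (suc L) in pL
... | true  = suc L , ≤-refl , pL , λ 1+L<j j≤1+L → contradiction j≤1+L (<⇒≱ 1+L<j)
... | false with last-true p p0 L
...   | i , i≤L , pi , after = i , m≤n⇒m≤1+n i≤L , pi , after′
  where
  after′ : ∀ {j} → i < j → j ≤ suc L → p j ≡ false
  after′ i<j j≤1+L with m≤n⇒m<n∨m≡n j≤1+L
  ... | inj₁ j<1+L = after i<j (s≤s⁻¹ j<1+L)
  ... | inj₂ refl  = pL

-- Periodic sequences and exits

gap : ∀ {a b} → a < b → ∃[ L ] (a + suc L ≡ b)
gap {a} {b} a<b = b ∸ suc a , trans (+-suc a (b ∸ suc a)) (m+[n∸m]≡n a<b)

-- Link ρ ρ′ j d: the d + 2 consecutive vertices from j lead from a ρ-vertex to a ρ′-vertex.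
Link : (ℕ → Bool) → (ℕ → Bool) → ℕ → ℕ → Set
Link ρ ρ′ j d = ρ j ≡ true × ρ′ (j + suc d) ≡ true

NoLink : ℕ → (ℕ → Bool) → (ℕ → Bool) → Set
NoLink D ρ ρ′ = ∀ j {d} → d < D → ρ j ≡ true → ρ′ (j + suc d) ≡ false

module Residues (m : ℕ) where

  n : ℕ
  n = suc m

  RespectsMod : {A : Set} → (ℕ → A) → Set
  RespectsMod f = ∀ a → f (a % n) ≡ f a

  mod-cong : ∀ {A : Set} {f : ℕ → A} → RespectsMod f → ∀ {a b} → a % n ≡ b % n → f a ≡ f b
  mod-cong {f = f} f-mod {a} {b} a≡b = trans (sym (f-mod a)) (trans (cong f a≡b) (f-mod b))

  %-+-cong : ∀ {a b} c → a % n ≡ b % n → (a + c) % n ≡ (b + c) % n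
  %-+-cong {a} {b} c a≡b = begin
    (a + c) % n             ≡⟨ %-distribˡ-+ a c n ⟩
    (a % n + c % n) % n     ≡⟨ cong (λ r → (r + c % n) % n) a≡b ⟩
    (b % n + c % n) % n     ≡⟨ %-distribˡ-+ b c n ⟨
    (b + c) % n             ∎
    where open ≡-Reasoning

  ∑-rotate-mod : ∀ {f : ℕ → ℕ} → RespectsMod f → ∀ c → ∑[ j < n ] f (j + c) ≡ ∑ n f
  ∑-rotate-mod {f} f-mod c =
    trans (∑-cong n (λ {j} _ → cong f (+-comm j c)))
          (∑-rotate n f (λ j → mod-cong f-mod ([m+n]%n≡m%n j n)) c)

  forward-distance : ∀ {r x} → r < n → x < n → r ≢ x → ∃[ L ] (suc L < n × (r + suc L) % n ≡ x % n)
  forward-distance {r} {x} r<n x<n r≢x with <-cmp r x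
  ... | tri≈ _ r≡x _ = contradiction r≡x r≢x
  ... | tri< r<x _ _ with gap r<x
  ...   | L , r+1+L≡x = L , ≤-<-trans (subst (suc L ≤_) r+1+L≡x (m≤n+m (suc L) r)) x<n
                          , cong (_% n) r+1+L≡x
  forward-distance {r} {x} r<n x<n r≢x | tri> _ _ x<r with gap (≤-trans r<n (m≤n+m n x))
  ...   | L , r+1+L≡x+n = L , +-cancelˡ-< r _ _ (subst (_< r + n) (sym r+1+L≡x+n) (+-monoˡ-< n x<r))
                          , trans (cong (_% n) r+1+L≡x+n) ([m+n]%n≡m%n x n)

  no-link-mod : ∀ {D ρ ρ′} → RespectsMod ρ → RespectsMod ρ′ →
                (∀ {j d} → j < n → d < D → ¬ Link ρ ρ′ j d) → NoLink D ρ ρ′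
  no-link-mod ρ-mod ρ′-mod unlinked j {d} d<D ρj = ¬-not λ ρ′j′ →
    unlinked (m%n<n j n) d<D ( trans (ρ-mod j) ρj
                             , trans (mod-cong ρ′-mod (%-+-cong {j % n} {j} (suc d) (m%n%n≡m%n j n))) ρ′j′)

module Exits (m D : ℕ) (occ : ℕ → Bool) (occ-mod : Residues.RespectsMod m occ) where
  open Residues m

  vacant : ℕ → ℕ → Bool
  vacant q zero    = true
  vacant q (suc k) = vacant q k ∧ not (occ (q + suc k))

  vacant⇒ : ∀ q k → vacant q k ≡ true → ∀ {a} → a < k → occ (q + suc a) ≡ false
  vacant⇒ q (suc k) h a<1+k with vacant q k in vk | occ (q + suc k) in ok
  ... | true  | false with m≤n⇒m<n∨m≡n (s≤s⁻¹ a<1+k)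
  ...   | inj₁ a<k  = vacant⇒ q k vk a<k
  ...   | inj₂ refl = ok
  vacant⇒ q (suc k) () a<1+k | true  | true
  vacant⇒ q (suc k) () a<1+k | false | _

  ⇒vacant : ∀ q k → (∀ {a} → a < k → occ (q + suc a) ≡ false) → vacant q k ≡ true
  ⇒vacant q zero    empty = refl
  ⇒vacant q (suc k) empty
    rewrite ⇒vacant q k (empty ∘ m<n⇒m<1+n) | empty (≤-refl {suc k}) = refl

  vacant-mod : ∀ k {q q′} → q % n ≡ q′ % n → vacant q k ≡ vacant q′ k
  vacant-mod zero    q≡q′ = refl
  vacant-mod (suc k) {q} {q′} q≡q′ =
    cong₂ _∧_ (vacant-mod k q≡q′) (cong not (mod-cong occ-mod (%-+-cong {q} {q′} (suc k) q≡q′)))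

  exit : ℕ → Bool
  exit q = occ q ∧ vacant q D

  exit-mod : RespectsMod exit
  exit-mod q = cong₂ _∧_ (occ-mod q) (vacant-mod D (m%n%n≡m%n q n))

  exit⇒occ : ∀ {q} → exit q ≡ true → occ q ≡ true
  exit⇒occ {q} h with occ q
  ... | true = refl

  exit⇒vacant : ∀ {q} → exit q ≡ true → ∀ {a} → a < D → occ (q + suc a) ≡ false
  exit⇒vacant {q} h with occ q
  ... | true = vacant⇒ q D h

  ⇒exit : ∀ {q} → occ q ≡ true → (∀ {a} → a < D → occ (q + suc a) ≡ false) → exit q ≡ true
  ⇒exit {q} oq empty rewrite oq = ⇒vacant q D empty

  exit-shadow : ∀ {x y} → exit x ≡ true → x < y → y ≤ x + D → occ y ≡ false
  exit-shadow {x} ex x<y y≤x+D with gap x<y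
  ... | L , refl = exit⇒vacant ex (+-cancelˡ-≤ x _ _ y≤x+D)

  exits-apart : ∀ {x y} → exit x ≡ true → exit y ≡ true → x < y → y ≤ x + D → ⊥
  exits-apart ex ey x<y y≤x+D = contradiction (trans (sym (exit⇒occ ey)) (exit-shadow ex x<y y≤x+D)) λ ()

  -- Inside D consecutive vertices there is at most one exit, and if there is one the vertex
  -- right after the window lies in its shadow.
  exits-in-window : ∀ q → count D (λ a → exit (q + a)) ≤ 𝟙 (not (occ (q + D)))
  exits-in-window q with anyUpTo? (λ a → exit (q + a) ≟ᵇ true) D
  ... | no none = subst (_≤ _) (sym (count-none D (λ a<D → ¬-not λ ea → none (_ , a<D , ea)))) z≤n
  ... | yes (a , a<D , ea)
        rewrite exit-shadow ea (+-monoʳ-< q a<D) (+-monoˡ-≤ D (m≤m+n q a)) =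
          count-≤1 D (λ a → exit (q + a)) unique
    where
    within : ∀ {b c} → c < D → q + c ≤ q + b + D
    within {b} c<D = ≤-trans (+-monoʳ-≤ q (<⇒≤ c<D)) (+-monoˡ-≤ D (m≤m+n q b))
    unique : ∀ {b c} → b < D → c < D → exit (q + b) ≡ true → exit (q + c) ≡ true → b ≡ c
    unique {b} {c} b<D c<D eb ec with <-cmp b c
    ... | tri< b<c _ _ = ⊥-elim (exits-apart eb ec (+-monoʳ-< q b<c) (within c<D))
    ... | tri≈ _ b≡c _ = b≡c
    ... | tri> _ _ c<b = ⊥-elim (exits-apart ec eb (+-monoʳ-< q c<b) (within b<D))

  -- Double counting of the pairs (q, a) with a < D and q + a an exit.
  exits-≤-vacancies : D * count n exit ≤ count n (not ∘ occ)
  exits-≤-vacancies = begin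
    D * count n exit                                 ≡⟨ ∑-const D (count n exit) ⟨
    ∑[ a < D ] count n exit                          ≡⟨ ∑-cong D (λ {a} _ → ∑-rotate-mod (cong 𝟙 ∘ exit-mod) a) ⟨
    ∑[ a < D ] ∑[ q < n ] 𝟙 (exit (q + a))           ≡⟨ ∑-comm n D (λ q a → 𝟙 (exit (q + a))) ⟨
    ∑[ q < n ] count D (λ a → exit (q + a))          ≤⟨ ∑-mono-≤ n (λ {q} _ → exits-in-window q) ⟩
    ∑[ q < n ] 𝟙 (not (occ (q + D)))                 ≡⟨ ∑-rotate-mod (cong (𝟙 ∘ not) ∘ occ-mod) D ⟩
    count n (not ∘ occ)                              ∎
    where
    open ≤-Reasoning

  module _ (ρ ρ′ : ℕ → Bool) (occ≡ : ∀ q → occ q ≡ ρ q ∨ ρ′ q) (no-link : NoLink D ρ ρ′) where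

    -- The last ρ-vertex before a ρ′-vertex is an exit.
    exit-before : ∀ p L → ρ p ≡ true → ρ′ (p + suc L) ≡ true →
                  ∃[ i ] (i ≤ L × ρ (p + i) ≡ true × exit (p + i) ≡ true)
    exit-before p L ρp ρ′p+1+L with last-true (λ i → ρ (p + i)) (trans (cong ρ (+-identityʳ p)) ρp) L
    ... | i , i≤L , ρi , after = i , i≤L , ρi , ⇒exit occupied empty
      where
      i+1+d≡1+L : i + suc (L ∸ i) ≡ suc L
      i+1+d≡1+L = trans (+-suc i (L ∸ i)) (cong suc (m+[n∸m]≡n i≤L))
      D≤d : D ≤ L ∸ i
      D≤d = ≮⇒≥ λ d<D → contradiction
        (trans (sym ρ′p+1+L) (trans (cong ρ′ p+1+L≡p+i+1+d) (no-link (p + i) d<D ρi))) λ ()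
        where
        p+1+L≡p+i+1+d : p + suc L ≡ p + i + suc (L ∸ i)
        p+1+L≡p+i+1+d = sym (trans (+-assoc p i _) (cong (p +_) i+1+d≡1+L))
      occupied : occ (p + i) ≡ true
      occupied rewrite occ≡ (p + i) | ρi = refl
      empty : ∀ {a} → a < D → occ (p + i + suc a) ≡ false
      empty {a} a<D rewrite occ≡ (p + i + suc a) | no-link (p + i) a<D ρi
                          | +-assoc p i (suc a)
                          | after (m<m+n i z<s)
                                  (≤-trans (+-monoʳ-≤ i (≤-trans a<D D≤d)) (≤-reflexive (m+[n∸m]≡n i≤L))) = refl

    -- Counted from r, the exit before x and x itself sit at the distinct positions i ≤ L < L + 1.
    two-exits : RespectsMod ρ′ → ∀ {r x} → r < n → x < n → r ≢ x →
                ρ r ≡ true → ρ′ x ≡ true → exit x ≡ true → 2 ≤ count n exit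
    two-exits ρ′-mod {r} {x} r<n x<n r≢x ρr ρ′x ex with forward-distance r<n x<n r≢x
    ... | L , 1+L<n , r+1+L≡x with exit-before r L ρr (trans (mod-cong ρ′-mod r+1+L≡x) ρ′x)
    ...   | i , i≤L , _ , ei =
      subst (2 ≤_) (∑-rotate n (𝟙 ∘ exit) (λ j → cong 𝟙 (mod-cong exit-mod ([m+n]%n≡m%n j n))) r)
            (count-≥2 n (λ j → exit (r + j)) (≤-<-trans i≤L (<-trans (n<1+n L) 1+L<n)) 1+L<n
                      (<⇒≢ (s≤s i≤L)) ei (trans (mod-cong exit-mod r+1+L≡x) ex))

module Unlinked (m D : ℕ) (σ τ : ℕ → Bool)
              (σ-mod : Residues.RespectsMod m σ) (τ-mod : Residues.RespectsMod m τ)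
              (no-link-στ : NoLink D σ τ) (no-link-τσ : NoLink D τ σ) where
  open Residues m

  occ : ℕ → Bool
  occ q = σ q ∨ τ q

  open Exits m D occ (λ q → cong₂ _∨_ (σ-mod q) (τ-mod q)) public

  both⇒exit : ∀ {q} → σ q ≡ true → τ q ≡ true → exit q ≡ true
  both⇒exit {q} σq τq = ⇒exit (cong (_∨ τ q) σq) empty
    where
    empty : ∀ {a} → a < D → occ (q + suc a) ≡ false
    empty a<D rewrite no-link-στ q a<D σq | no-link-τσ q a<D τq = refl

  exit-count-bound : count n σ + count n τ + D * count n exit ≤ n + count n exit
  exit-count-bound = begin
    count n σ + count n τ + D * count n exit    ≤⟨ +-monoʳ-≤ (count n σ + count n τ) exits-≤-vacancies ⟩
    count n σ + count n τ + count n (not ∘ occ) ≡⟨ count-inclusion-exclusion n σ τ ⟩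
    n + count n (λ q → σ q ∧ τ q)               ≤⟨ +-monoʳ-≤ n (count-mono n (λ {q} _ → both)) ⟩
    n + count n exit                            ∎
    where
    open ≤-Reasoning
    ∧-true : ∀ {x y} → x ∧ y ≡ true → x ≡ true × y ≡ true
    ∧-true {true} {true} _ = refl , refl
    both : ∀ {q} → σ q ∧ τ q ≡ true → exit q ≡ true
    both h = both⇒exit (proj₁ (∧-true h)) (proj₂ (∧-true h))

  -- The last σ-vertex x before some τ-vertex is an exit.  A second exit is the last σ-vertex
  -- before x starting from another σ-vertex if x ∈ T, and the last τ-vertex before x otherwise.
  at-least-two-exits : 2 ≤ count n σ → 1 ≤ count n τ → 2 ≤ count n exit
  at-least-two-exits 2≤∣σ∣ 1≤∣τ∣
    with count-witness n σ (≤-trans (s≤s z≤n) 2≤∣σ∣) | count-witness n τ 1≤∣τ∣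
  ... | s , s<n , σs | t , t<n , τt with gap (≤-trans s<n (m≤n+m n t))
  ... | L , s+1+L≡t+n
        with exit-before σ τ (λ _ → refl) no-link-στ s L σs
               (trans (mod-cong τ-mod (trans (cong (_% n) s+1+L≡t+n) ([m+n]%n≡m%n t n))) τt)
  ... | i , _ , σy , ey = second-exit (m%n<n (s + i) n) (trans (σ-mod (s + i)) σy) (trans (exit-mod (s + i)) ey)
    where
    second-exit : ∀ {x} → x < n → σ x ≡ true → exit x ≡ true → 2 ≤ count n exit
    second-exit {x} x<n σx ex with τ x ≟ᵇ true
    ... | yes τx with count-witness-≢ n σ 2≤∣σ∣ x
    ...   | r , r<n , r≢x , σr = two-exits σ τ (λ _ → refl) no-link-στ τ-mod r<n x<n r≢x σr τx ex
    second-exit {x} x<n σx ex | no ¬τx =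
      two-exits τ σ (λ q → ∨-comm (σ q) (τ q)) no-link-τσ σ-mod t<n x<n t≢x τt σx ex
      where
      t≢x : t ≢ x
      t≢x refl = ¬τx τt

-- Choice of the window length

-- The counting argument needs 6 D ≥ n + 6; D = ⌊(n + 11) / 6⌋ is the least such D.
window-length : ∀ n → 3 ≤ n → ∃[ D ] (n + 6 ≤ 6 * D × 6 * suc D ≤ n + 24 × suc D ≤ n)
window-length n 3≤n = D , n+6≤6D , ≤-trans 6+6D≤n+17 (+-monoʳ-≤ n (from-yes (17 ≤? 24))) , 1+D≤n
  where
  D : ℕ
  D = (n + 11) / 6
  n+11≡r+6D : n + 11 ≡ (n + 11) % 6 + 6 * D
  n+11≡r+6D = trans (m≡m%n+[m/n]*n (n + 11) 6) (cong ((n + 11) % 6 +_) (*-comm D 6))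
  n+6≤6D : n + 6 ≤ 6 * D
  n+6≤6D = +-cancelʳ-≤ 5 (n + 6) (6 * D) (begin
    n + 6 + 5              ≡⟨ +-assoc n 6 5 ⟩
    n + 11                 ≡⟨ n+11≡r+6D ⟩
    (n + 11) % 6 + 6 * D   ≤⟨ +-monoˡ-≤ (6 * D) (≤-pred (m%n<n (n + 11) 6)) ⟩
    5 + 6 * D              ≡⟨ +-comm 5 (6 * D) ⟩
    6 * D + 5              ∎)
    where open ≤-Reasoning
  6+6D≤n+17 : 6 * suc D ≤ n + 17
  6+6D≤n+17 = begin
    6 * suc D              ≡⟨ *-suc 6 D ⟩
    6 + 6 * D              ≤⟨ +-monoʳ-≤ 6 (subst (6 * D ≤_) (sym n+11≡r+6D) (m≤n+m (6 * D) ((n + 11) % 6))) ⟩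
    6 + (n + 11)           ≡⟨ solve 1 (λ n → con 6 :+ (n :+ con 11) := n :+ con 17) refl n ⟩
    n + 17                 ∎
    where open ≤-Reasoning
  1+D≤n : suc D ≤ n
  1+D≤n = ≤-pred (*-cancelˡ-< 6 (suc D) (suc n) (begin-strict
    6 * suc D              ≤⟨ 6+6D≤n+17 ⟩
    n + 17                 <⟨ +-monoʳ-< n (≤-trans (from-yes (18 ≤? 21)) (+-monoˡ-≤ 6 (*-monoʳ-≤ 5 3≤n))) ⟩
    n + (5 * n + 6)        ≡⟨ solve 1 (λ n → n :+ (con 5 :* n :+ con 6) := con 6 :* (con 1 :+ n)) refl n ⟩
    6 * suc n              ∎))
    where open ≤-Reasoning

counting-contradiction : ∀ {n s t e D} → s + t + D * e ≤ n + e → 2 ≤ e →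
                         n < 3 * s → n < 3 * t → n + 6 ≤ 6 * D → ⊥
counting-contradiction {n} {D = zero} _ _ _ _ n+6≤0 = contradiction (subst (_≤ 0) (+-comm n 6) n+6≤0) λ ()
counting-contradiction {n} {s} {t} {e} {suc D′} bound 2≤e n<3s n<3t n+6≤6+6D′ =
  1+n≰n (≤-trans (n≤1+n _) (begin
    2 + 3 * n                     ≡⟨ solve 1 (λ n → con 2 :+ con 3 :* n
                                                   := con 1 :+ n :+ (con 1 :+ n) :+ n) refl n ⟩
    suc n + suc n + n             ≤⟨ +-mono-≤ (+-mono-≤ n<3s n<3t) n≤6D′ ⟩
    3 * s + 3 * t + 6 * D′        ≡⟨ solve 3 (λ s t d → con 3 :* s :+ con 3 :* t :+ con 6 :* d
                                                   := con 3 :* (s :+ t :+ d :* con 2)) refl s t D′ ⟩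
    3 * (s + t + D′ * 2)          ≤⟨ *-monoʳ-≤ 3 s+t+2D′≤n ⟩
    3 * n                         ∎))
  where
  open ≤-Reasoning
  n≤6D′ : n ≤ 6 * D′
  n≤6D′ = +-cancelʳ-≤ 6 n (6 * D′) (subst (n + 6 ≤_) (trans (*-suc 6 D′) (+-comm 6 (6 * D′))) n+6≤6+6D′)
  s+t+2D′≤n : s + t + D′ * 2 ≤ n
  s+t+2D′≤n = ≤-trans (+-monoʳ-≤ (s + t) (*-monoʳ-≤ D′ 2≤e)) (+-cancelʳ-≤ e (s + t + D′ * e) n (begin
    s + t + D′ * e + e            ≡⟨ solve 4 (λ s t d e → s :+ t :+ d :* e :+ e
                                                       := s :+ t :+ (con 1 :+ d) :* e) refl s t D′ e ⟩
    s + t + suc D′ * e            ≤⟨ bound ⟩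
    n + e                         ∎))

-- Subsets of the cycle

_‼_ : ∀ {k} → Vec Bool k → ℕ → Bool
[]       ‼ j     = false
(b ∷ _)  ‼ zero  = b
(_ ∷ bs) ‼ suc j = bs ‼ j

lookup-‼ : ∀ {k} (bs : Vec Bool k) (i : Fin k) → lookup bs i ≡ bs ‼ toℕ i
lookup-‼ (b ∷ bs) Fin.zero    = refl
lookup-‼ (b ∷ bs) (Fin.suc i) = lookup-‼ bs i

‼-∈ : ∀ {k} (S : Subset k) (i : Fin k) → S ‼ toℕ i ≡ true → i ∈ S
‼-∈ S i S‼i = lookup⇒[]= i S (trans (lookup-‼ S i) S‼i)

∣∣≡count : ∀ {k} (S : Subset k) → ∣ S ∣ ≡ count k (S ‼_)
∣∣≡count []               = refl
∣∣≡count {suc k} (true ∷ S)  = trans (cong suc (∣∣≡count S)) (sym (∑-unfoldˡ k (𝟙 ∘ ((true ∷ S) ‼_))))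
∣∣≡count {suc k} (false ∷ S) = trans (∣∣≡count S) (sym (∑-unfoldˡ k (𝟙 ∘ ((false ∷ S) ‼_))))

toℕ-walk : ∀ {m} (i : Fin (suc m)) c → toℕ (walk i c) ≡ (toℕ i + c) % suc m
toℕ-walk {m} i zero = sym (trans (cong (_% suc m) (+-identityʳ (toℕ i))) (m<n⇒m%n≡m (toℕ<n i)))
toℕ-walk {m} i (suc c) = begin
  toℕ (walk i (suc c))          ≡⟨ toℕ-fromℕ< _ ⟩
  suc (toℕ (walk i c)) % n      ≡⟨ cong (λ r → suc r % n) (toℕ-walk i c) ⟩
  suc ((toℕ i + c) % n) % n     ≡⟨ cong (_% n) (+-comm 1 _) ⟩
  ((toℕ i + c) % n + 1) % n     ≡⟨ %-+-cong {(toℕ i + c) % n} {toℕ i + c} 1 (m%n%n≡m%n (toℕ i + c) n) ⟩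
  (toℕ i + c + 1) % n           ≡⟨ cong (_% n) (trans (+-assoc (toℕ i) c 1) (cong (toℕ i +_) (+-comm c 1))) ⟩
  (toℕ i + suc c) % n           ∎
  where
  open ≡-Reasoning
  open Residues m

arc : ∀ {m} (j d : ℕ) → suc (suc d) ≤ suc m → CyclePath (suc m)
arc {m} j d 2+d≤n = path (j mod suc m) (suc (suc d)) (s≤s z≤n) 2+d≤n

toℕ-end₁-arc : ∀ {m} j d 2+d≤n → toℕ (end₁ (arc {m} j d 2+d≤n)) ≡ j % suc m
toℕ-end₁-arc j d 2+d≤n = toℕ-fromℕ< _

toℕ-end₂-arc : ∀ {m} j d 2+d≤n → toℕ (end₂ (arc {m} j d 2+d≤n)) ≡ (j + suc d) % suc m
toℕ-end₂-arc {m} j d 2+d≤n = trans (toℕ-walk (j mod n) (suc d))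
  (%-+-cong {toℕ (j mod n)} {j} (suc d) (trans (cong (_% n) (toℕ-fromℕ< (m%n<n j n))) (m%n%n≡m%n j n)))
  where
  open Residues m

more-than-a-third : ∀ {n s} → 3 ≤ n → n < 3 * s → 2 ≤ s
more-than-a-third 3≤n n<3s = ≮⇒≥ λ s<2 → <⇒≱ (<-≤-trans n<3s (*-monoʳ-≤ 3 (≤-pred s<2))) 3≤n

module OnCycle (m : ℕ) (S T : Subset (suc m)) where
  open Residues m

  σ τ : ℕ → Bool
  σ j = S ‼ (j % n)
  τ j = T ‼ (j % n)

  σ-mod : RespectsMod σ
  σ-mod a = cong (S ‼_) (m%n%n≡m%n a n)

  τ-mod : RespectsMod τ
  τ-mod a = cong (T ‼_) (m%n%n≡m%n a n)

  Linked : ℕ → ℕ → Set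
  Linked j d = Link σ τ j d ⊎ Link τ σ j d

  linked? : ∀ j d → Dec (Linked j d)
  linked? j d =     ((σ j ≟ᵇ true) ×-dec (τ (j + suc d) ≟ᵇ true))
                ⊎-dec ((τ j ≟ᵇ true) ×-dec (σ (j + suc d) ≟ᵇ true))

  ∈-at : ∀ (U : Subset n) {i : Fin n} k → toℕ i ≡ k % n → U ‼ (k % n) ≡ true → i ∈ U
  ∈-at U {i} k i≡k U‼k = ‼-∈ U i (trans (cong (U ‼_) i≡k) U‼k)

  linked⇒ends : ∀ {j d} 2+d≤n → Linked j d → let P = arc j d 2+d≤n in
                (end₁ P ∈ S × end₂ P ∈ T) ⊎ (end₁ P ∈ T × end₂ P ∈ S)
  linked⇒ends {j} {d} 2+d≤n (inj₁ (σj , τj′)) =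
    inj₁ (∈-at S j (toℕ-end₁-arc j d 2+d≤n) σj , ∈-at T (j + suc d) (toℕ-end₂-arc j d 2+d≤n) τj′)
  linked⇒ends {j} {d} 2+d≤n (inj₂ (τj , σj′)) =
    inj₂ (∈-at T j (toℕ-end₁-arc j d 2+d≤n) τj , ∈-at S (j + suc d) (toℕ-end₂-arc j d 2+d≤n) σj′)

  count≡∣∣ : ∀ (U : Subset n) → count n (λ j → U ‼ (j % n)) ≡ ∣ U ∣
  count≡∣∣ U = trans (∑-cong n (λ j<n → cong (𝟙 ∘ (U ‼_)) (m<n⇒m%n≡m j<n))) (sym (∣∣≡count U))

  short-link? : ∀ D → Dec (∃[ j ] (j < n × ∃[ d ] (d < D × Linked j d)))
  short-link? D = anyUpTo? (λ j → anyUpTo? (linked? j) D) n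

  linked⇒path : ∀ {D} j {d} → d < D → suc D ≤ n → 6 * suc D ≤ n + 24 → Linked j d →
                ∃[ P ] (2 ≤ #vertices {n} P × 6 * #vertices P ≤ n + 24 ×
                  ((end₁ P ∈ S × end₂ P ∈ T) ⊎ (end₁ P ∈ T × end₂ P ∈ S)))
  linked⇒path j {d} d<D 1+D≤n 6+6D≤n+24 linked =
    arc j d 2+d≤n , s≤s (s≤s z≤n) , ≤-trans (*-monoʳ-≤ 6 (s≤s d<D)) 6+6D≤n+24
                  , linked⇒ends {j} {d} 2+d≤n linked
    where
    2+d≤n : suc (suc d) ≤ n
    2+d≤n = ≤-trans (s≤s d<D) 1+D≤n

  unlinked⇒⊥ : ∀ {D} → ¬ (∃[ j ] (j < n × ∃[ d ] (d < D × Linked j d))) →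
               3 ≤ n → n < 3 * ∣ S ∣ → n < 3 * ∣ T ∣ → n + 6 ≤ 6 * D → ⊥
  unlinked⇒⊥ {D} unlinked 3≤n n<3∣S∣ n<3∣T∣ n+6≤6D =
    counting-contradiction {n} {count n σ} {count n τ} {count n exit} {D} exit-count-bound
      (at-least-two-exits (more-than-a-third 3≤n n<3s) (≤-trans (n≤1+n 1) (more-than-a-third 3≤n n<3t)))
      n<3s n<3t n+6≤6D
    where
    no-link-στ : NoLink D σ τ
    no-link-στ = no-link-mod σ-mod τ-mod λ j<n d<D link → unlinked (_ , j<n , _ , d<D , inj₁ link)
    no-link-τσ : NoLink D τ σ
    no-link-τσ = no-link-mod τ-mod σ-mod λ j<n d<D link → unlinked (_ , j<n , _ , d<D , inj₂ link)
    open Unlinked m D σ τ σ-mod τ-mod no-link-στ no-link-τσ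
    n<3s : n < 3 * count n σ
    n<3s = subst (λ c → n < 3 * c) (sym (count≡∣∣ S)) n<3∣S∣
    n<3t : n < 3 * count n τ
    n<3t = subst (λ c → n < 3 * c) (sym (count≡∣∣ T)) n<3∣T∣

lemma4 : (n : ℕ) → 3 ≤ n → (S T : Subset n) → n < 3 * ∣ S ∣ → n < 3 * ∣ T ∣ →
    ∃[ P ] (2 ≤ #vertices {n} P × 6 * #vertices P ≤ n + 24 ×
    ((end₁ P ∈ S × end₂ P ∈ T) ⊎ (end₁ P ∈ T × end₂ P ∈ S)))
lemma4 zero () S T n<3∣S∣ n<3∣T∣
lemma4 (suc m) 3≤n S T n<3∣S∣ n<3∣T∣ with window-length (suc m) 3≤n
... | D , n+6≤6D , 6+6D≤n+24 , 1+D≤n with OnCycle.short-link? m S T D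
...   | yes (j , _ , _ , d<D , linked) = OnCycle.linked⇒path m S T j d<D 1+D≤n 6+6D≤n+24 linked
...   | no unlinked = ⊥-elim (OnCycle.unlinked⇒⊥ m S T unlinked 3≤n n<3∣S∣ n<3∣T∣ n+6≤6D)
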